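{- Let $n\in\mathbb{N}$, $t\in\mathbb{N}$ and $k\in[n]=\{1,\dots,n\}$. Let $P\in\mathbb{R}[x_1,\dots,x_n]$ be a polynomial such that at each point $u\in\mathcal{Q}^n\setminus\mathcal{Q}^n_k$, $P$ has a zero of multiplicity at least $t$, and at each point $v\in\mathcal{Q}^n_k$, $P$ has a zero of multiplicity exactly $t-1$. Then $$\deg(P)\geq \max\{k,n-k\}+2t-2.$$
   Context: $\mathcal{Q}^n=\{0,1\}^n\subset\mathbb{R}^n$ is the hypercube, and for $k\in\{0,\dots,n\}$ the $k$-th layer $\mathcal{Q}^n_k$ is the set of points of $\mathcal{Q}^n$ having exactly $k$ coordinates equal to $1$. A polynomial $P$ has a zero of multiplicity at least $s$ at $v\in\mathbb{R}^n$ if $P$ and all its partial derivatives of order at most $s-1$ vanish at $v$ (for $s=0$ this is no condition). $P$ has a zero of multiplicity exactly $s$ at $v$ if it has a zero of multiplicity at least $s$ but not of multiplicity at least $s+1$ at $v$ (so multiplicity exactly $0$ means $P(v)\neq 0$). -}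

module Defs where

open import Level using (0ℓ)
open import Data.Nat as ℕ using (ℕ; zero; suc; _≤_; _<_; _∸_)
open import Data.Bool using (Bool; true; false; if_then_else_)
open import Data.Fin using (Fin)
import Data.Fin as Fin
import Data.Bool
open import Data.List using (List; []; _∷_; length)
open import Data.Vec using (Vec; lookup; updateAt; count)
import Data.Vec as Vec
open import Data.Vec.Properties using (≡-dec)
open import Data.Product using (Σ; ∃; _×_; _,_)
open import Relation.Nullary using (¬_; yes; no)
open import Relation.Binary.PropositionalEquality using (_≡_; _≢_)
open import Relation.Binary.Structures using (IsStrictTotalOrder)
open import Algebra.Structures using (IsCommutativeRing)
open import Function using (id)

-- An axiomatic model of the real numbers: a Dedekind-complete ordered field
-- (with propositional equality as the equality of reals).
record RealField : Set₁ where
  infixl 6 _+_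
  infixl 7 _*_
  infix 4 _<ᵣ_
  field
    ℝ    : Set
    0ᵣ 1ᵣ : ℝ
    _+_ _*_ : ℝ → ℝ → ℝ
    -_   : ℝ → ℝ
    _<ᵣ_ : ℝ → ℝ → Set
    isCommutativeRing : IsCommutativeRing _≡_ _+_ _*_ -_ 0ᵣ 1ᵣ
    0≢1  : 0ᵣ ≢ 1ᵣ
    inverse : ∀ x → x ≢ 0ᵣ → Σ ℝ (λ y → x * y ≡ 1ᵣ)
    isStrictTotalOrder : IsStrictTotalOrder _≡_ _<ᵣ_
    +-mono-< : ∀ x y z → x <ᵣ y → x + z <ᵣ y + z
    *-pos : ∀ x y → 0ᵣ <ᵣ x → 0ᵣ <ᵣ y → 0ᵣ <ᵣ x * y
    sup : (S : ℝ → Set) → ∃ S → ∃ (λ b → ∀ x → S x → ¬ (b <ᵣ x)) →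
          ∃ (λ s → (∀ x → S x → ¬ (s <ᵣ x)) ×
                   (∀ b → (∀ x → S x → ¬ (b <ᵣ x)) → ¬ (b <ᵣ s)))

module Poly (Rf : RealField) where
  open RealField Rf

  fromℕ : ℕ → ℝ
  fromℕ zero    = 0ᵣ
  fromℕ (suc m) = 1ᵣ + fromℕ m

  _^_ : ℝ → ℕ → ℝ
  x ^ zero  = 1ᵣ
  x ^ suc m = x * (x ^ m)

  Monomial : ℕ → Set
  Monomial n = Vec ℕ n

  totalDegree : ∀ {n} → Monomial n → ℕ
  totalDegree = Vec.sum

  -- a polynomial in ℝ[x₁,…,xₙ], as a finite formal sum of terms c·x^α
  Polynomial : ℕ → Set
  Polynomial n = List (ℝ × Monomial n)

  evalMono : ∀ {n} → Monomial n → (Fin n → ℝ) → ℝ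
  evalMono Vec.[]      x = 1ᵣ
  evalMono (a Vec.∷ α) x = (x Fin.zero ^ a) * evalMono α (λ i → x (Fin.suc i))

  eval : ∀ {n} → Polynomial n → (Fin n → ℝ) → ℝ
  eval []            x = 0ᵣ
  eval ((c , α) ∷ P) x = c * evalMono α x + eval P x

  coeff : ∀ {n} → Polynomial n → Monomial n → ℝ
  coeff []            β = 0ᵣ
  coeff ((c , α) ∷ P) β with ≡-dec ℕ._≟_ α β
  ... | yes _ = c + coeff P β
  ... | no  _ = coeff P β

  ∂ : ∀ {n} → Fin n → Polynomial n → Polynomial n
  ∂ i []            = []
  ∂ i ((c , α) ∷ P) = (c * fromℕ (lookup α i) , updateAt α i (_∸ 1)) ∷ ∂ i P

  ∂* : ∀ {n} → List (Fin n) → Polynomial n → Polynomial n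
  ∂* []       P = P
  ∂* (i ∷ is) P = ∂ i (∂* is P)

  -- P has a zero of multiplicity at least s at v:
  -- all partial derivatives of order ≤ s-1 (i.e. < s) vanish at v
  ZeroMultAtLeast : ∀ {n} → Polynomial n → ℕ → (Fin n → ℝ) → Set
  ZeroMultAtLeast P s v = ∀ is → length is < s → eval (∂* is P) v ≡ 0ᵣ

  ZeroMultExactly : ∀ {n} → Polynomial n → ℕ → (Fin n → ℝ) → Set
  ZeroMultExactly P s v = ZeroMultAtLeast P s v × ¬ ZeroMultAtLeast P (suc s) v

  DegreeAtLeast : ∀ {n} → Polynomial n → ℕ → Set
  DegreeAtLeast P d = ¬ (∀ α → d ≤ totalDegree α → coeff P α ≡ 0ᵣ)

  -- hypercube points {0,1}ⁿ, encoded as Boolean vectors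
  cubePoint : ∀ {n} → Vec Bool n → Fin n → ℝ
  cubePoint u i = if lookup u i then 1ᵣ else 0ᵣ

  -- number of coordinates equal to 1 (u ∈ Qⁿ_k iff weight u ≡ k)
  weight : ∀ {n} → Vec Bool n → ℕ
  weight = count (λ b → Data.Bool._≟_ b true)

{-# OPTIONS --safe #-}
-- Suppose deg P < max(k, n-k) + 2(t-1).  Fix v on the layer k, a side L ∈ {0,1} such that v differs
-- from L in max(k, n-k) coordinates, and a multi-index β with |β| = t-1.  For each coordinate i there are
-- weights μᵢ(b, g), b ∈ {0,1}, g ≤ βᵢ, such that f ↦ Σ μᵢ(b, g) f⁽ᵍ⁾(b) kills x^a for a < 2βᵢ + [vᵢ ≠ L],
-- μᵢ(vᵢ, βᵢ) ≠ 0, and μᵢ(1-L, βᵢ) = 0 when vᵢ = L.  The tensor product functional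
-- Φ(P) = Σ_{u ∈ Qⁿ, γ ≤ β} ∏ᵢ μᵢ(uᵢ, γᵢ) ∂^γ P(u) kills every monomial of degree < 2|β| + max(k, n-k),
-- hence Φ(P) = 0.  But in Φ(P) the terms with γ ≠ β vanish as |γ| < t-1, and those with γ = β, u ≠ v
-- vanish too: either their weight is 0, or u has L wherever v has, which puts u off the layer k.
-- So ∂^β P(v) = 0 for all |β| = t-1, i.e. P vanishes to order t at v, contradicting exactness.

module Submission where

open import Defs
open import Level using (0ℓ)
open import Data.Nat as ℕ using (ℕ; zero; suc; _≤_; _<_; _∸_; z≤n; s≤s)
import Data.Nat.Properties as ℕ
open import Data.Fin as Fin using (Fin; toℕ; fromℕ<; punchIn)
import Data.Fin.Properties as Fin
open import Data.Bool using (Bool; true; false; not; if_then_else_) renaming (_≟_ to _≟ᵇ_)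
open import Data.Bool.Properties using (¬-not)
open import Data.List as List using (List; []; _∷_; length)
import Data.List.Properties as List
open import Data.Vec as Vec using (Vec; []; _∷_; lookup; updateAt; zipWith; replicate)
import Data.Vec.Properties as Vec
open import Data.Product using (Σ; _×_; _,_; proj₁; proj₂)
open import Data.Sum using (_⊎_; inj₁; inj₂)
import Data.Sum as Sum
open import Data.Empty using (⊥-elim)
open import Function using (_∘_)
open import Relation.Nullary using (Dec; yes; no)
open import Relation.Binary.PropositionalEquality
open import Relation.Binary.Structures using (IsStrictTotalOrder)
open import Relation.Binary.Definitions using (tri<; tri≈; tri>)
open import Data.Vec.Relation.Binary.Pointwise.Inductive as Pointwise using (Pointwise; []; _∷_)
open import Algebra.Bundles using (CommutativeRing)
open import Data.Nat.Tactic.RingSolver using (solve-∀)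

module FieldFacts (Rf : RealField) where
  open RealField Rf
  open Poly Rf using (fromℕ)

  commutativeRing : CommutativeRing 0ℓ 0ℓ
  commutativeRing = record { isCommutativeRing = isCommutativeRing }

  open CommutativeRing commutativeRing public
    using ( +-assoc; +-comm; +-identityˡ; +-identityʳ; -‿inverseˡ; -‿inverseʳ
          ; *-assoc; *-comm; *-identityˡ; *-identityʳ; zeroˡ; zeroʳ
          ; ring; commutativeSemiring; +-commutativeMonoid; semiring )
  open import Algebra.Properties.Ring ring public
    using (-‿involutive; -0#≈0#; -‿distribˡ-*; +-cancelˡ; x∙y⁻¹≈ε⇒x≈y; x≈z//y)
  open import Algebra.Solver.Ring.NaturalCoefficients.Default commutativeSemiring public
    using (solve; _:+_; _:*_; _:=_)
  open IsStrictTotalOrder isStrictTotalOrder using (compare; irrefl; asym) renaming (trans to <-trans)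

  1≢0 : 1ᵣ ≢ 0ᵣ
  1≢0 = 0≢1 ∘ sym

  x*y≡0⇒y≡0 : ∀ {x y} → x ≢ 0ᵣ → x * y ≡ 0ᵣ → y ≡ 0ᵣ
  x*y≡0⇒y≡0 {x} {y} x≢0 xy≡0 = begin
      y                ≡⟨ sym (*-identityˡ y) ⟩
      1ᵣ * y           ≡⟨ cong (_* y) (sym (trans (*-comm x⁻¹ x) (proj₂ (inverse x x≢0)))) ⟩
      (x⁻¹ * x) * y    ≡⟨ *-assoc x⁻¹ x y ⟩
      x⁻¹ * (x * y)    ≡⟨ cong (x⁻¹ *_) xy≡0 ⟩
      x⁻¹ * 0ᵣ         ≡⟨ zeroʳ x⁻¹ ⟩
      0ᵣ               ∎
    where
      open ≡-Reasoning
      x⁻¹ : ℝ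
      x⁻¹ = proj₁ (inverse x x≢0)

  *-≢0 : ∀ {x y} → x ≢ 0ᵣ → y ≢ 0ᵣ → x * y ≢ 0ᵣ
  *-≢0 x≢0 y≢0 = y≢0 ∘ x*y≡0⇒y≡0 x≢0

  -‿≢0 : ∀ {x} → x ≢ 0ᵣ → - x ≢ 0ᵣ
  -‿≢0 {x} x≢0 -x≡0 = x≢0 (trans (sym (-‿involutive x)) (trans (cong -_ -x≡0) -0#≈0#))

  x*y≡1⇒y≢0 : ∀ {x y} → x * y ≡ 1ᵣ → y ≢ 0ᵣ
  x*y≡1⇒y≢0 {x} xy≡1 y≡0 = 0≢1 (trans (sym (zeroʳ x)) (trans (cong (x *_) (sym y≡0)) xy≡1))

  0<1 : 0ᵣ <ᵣ 1ᵣ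
  0<1 with compare 0ᵣ 1ᵣ
  ... | tri< 0<1 _ _ = 0<1
  ... | tri≈ _ 0≡1 _ = ⊥-elim (0≢1 0≡1)
  ... | tri> _ _ 1<0 = ⊥-elim (asym 1<0 (subst (0ᵣ <ᵣ_) [-1]*[-1]≡1 (*-pos _ _ 0<-1 0<-1)))
    where
      0<-1 : 0ᵣ <ᵣ - 1ᵣ
      0<-1 = subst₂ _<ᵣ_ (-‿inverseʳ 1ᵣ) (+-identityˡ (- 1ᵣ)) (+-mono-< 1ᵣ 0ᵣ (- 1ᵣ) 1<0)
      [-1]*[-1]≡1 : - 1ᵣ * - 1ᵣ ≡ 1ᵣ
      [-1]*[-1]≡1 = begin
          - 1ᵣ * - 1ᵣ      ≡⟨ sym (-‿distribˡ-* 1ᵣ (- 1ᵣ)) ⟩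
          - (1ᵣ * - 1ᵣ)    ≡⟨ cong -_ (*-identityˡ (- 1ᵣ)) ⟩
          - (- 1ᵣ)         ≡⟨ -‿involutive 1ᵣ ⟩
          1ᵣ               ∎
        where open ≡-Reasoning

  fromℕ-suc-pos : ∀ m → 0ᵣ <ᵣ fromℕ (suc m)
  fromℕ-suc-pos zero = subst (0ᵣ <ᵣ_) (sym (+-identityʳ 1ᵣ)) 0<1
  fromℕ-suc-pos (suc m) = <-trans 0<1
    (subst₂ _<ᵣ_ (+-identityˡ 1ᵣ) (+-comm _ 1ᵣ) (+-mono-< 0ᵣ (fromℕ (suc m)) 1ᵣ (fromℕ-suc-pos m)))

  fromℕ-suc-≢0 : ∀ m → fromℕ (suc m) ≢ 0ᵣ
  fromℕ-suc-≢0 m e = irrefl (sym e) (fromℕ-suc-pos m)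

  fromℕ-injective : ∀ {a b} → fromℕ a ≡ fromℕ b → a ≡ b
  fromℕ-injective {zero}  {zero}  _ = refl
  fromℕ-injective {zero}  {suc b} e = ⊥-elim (fromℕ-suc-≢0 b (sym e))
  fromℕ-injective {suc a} {zero}  e = ⊥-elim (fromℕ-suc-≢0 a e)
  fromℕ-injective {suc a} {suc b} e = cong suc (fromℕ-injective (+-cancelˡ 1ᵣ _ _ e))

  fromℕ-+ : ∀ a b → fromℕ (a ℕ.+ b) ≡ fromℕ a + fromℕ b
  fromℕ-+ zero    b = sym (+-identityˡ _)
  fromℕ-+ (suc a) b = trans (cong (1ᵣ +_) (fromℕ-+ a b)) (sym (+-assoc _ _ _))

  fromℕ-∸ : ∀ {a b} → b ≤ a → fromℕ (a ∸ b) ≡ fromℕ a + - fromℕ b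
  fromℕ-∸ {a} {b} b≤a = x≈z//y _ _ _ (begin
      fromℕ (a ∸ b) + fromℕ b  ≡⟨ sym (fromℕ-+ (a ∸ b) b) ⟩
      fromℕ (a ∸ b ℕ.+ b)      ≡⟨ cong fromℕ (ℕ.m∸n+n≡m b≤a) ⟩
      fromℕ a                  ∎)
    where open ≡-Reasoning

  fromℕ-difference-≢0 : ∀ {a b} → a ≢ b → fromℕ a + - fromℕ b ≢ 0ᵣ
  fromℕ-difference-≢0 a≢b = a≢b ∘ fromℕ-injective ∘ x∙y⁻¹≈ε⇒x≈y _ _

module FiniteSums (Rf : RealField) where
  open RealField Rf
  open FieldFacts Rf
  open import Algebra.Properties.CommutativeMonoid.Sum +-commutativeMonoid
    using (sum; sum-cong-≗; sum-replicate-zero; ∑-distrib-+; sum-remove)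
  open import Algebra.Properties.Semiring.Sum semiring using (*-distribˡ-sum)

  ∑< : ℕ → (ℕ → ℝ) → ℝ
  ∑< N f = sum {N} (f ∘ toℕ)

  ∑<-cong : ∀ N {f h : ℕ → ℝ} → (∀ g → g < N → f g ≡ h g) → ∑< N f ≡ ∑< N h
  ∑<-cong N f≡h = sum-cong-≗ (λ i → f≡h (toℕ i) (Fin.toℕ<n i))

  ∑<-zero : ∀ N {f : ℕ → ℝ} → (∀ g → g < N → f g ≡ 0ᵣ) → ∑< N f ≡ 0ᵣ
  ∑<-zero N f≡0 = trans (∑<-cong N f≡0) (sum-replicate-zero N)

  ∑<-+ : ∀ N (f h : ℕ → ℝ) → ∑< N (λ g → f g + h g) ≡ ∑< N f + ∑< N h
  ∑<-+ N f h = ∑-distrib-+ {N} (f ∘ toℕ) (h ∘ toℕ)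

  ∑<-*ˡ : ∀ N c (f : ℕ → ℝ) → ∑< N (λ g → c * f g) ≡ c * ∑< N f
  ∑<-*ˡ N c f = sym (*-distribˡ-sum {N} c (f ∘ toℕ))

  ∑bit≤ : ℕ → (Bool → ℕ → ℝ) → ℝ
  ∑bit≤ m f = ∑< (suc m) (f false) + ∑< (suc m) (f true)

  ∑<-single : ∀ {N} a (f : ℕ → ℝ) → a < N → (∀ g → g < N → g ≢ a → f g ≡ 0ᵣ) → ∑< N f ≡ f a
  ∑<-single {suc N} a f a<N f≡0 = begin
      ∑< (suc N) f                             ≡⟨ sum-remove {i = i} (f ∘ toℕ) ⟩
      f (toℕ i) + sum (f ∘ toℕ ∘ punchIn i)    ≡⟨ cong₂ _+_ (cong f (Fin.toℕ-fromℕ< a<N)) (trans (sum-cong-≗ rest≡0) (sum-replicate-zero N)) ⟩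
      f a + 0ᵣ                                 ≡⟨ +-identityʳ (f a) ⟩
      f a                                      ∎
    where
      open ≡-Reasoning
      i : Fin (suc N)
      i = fromℕ< a<N
      rest≡0 : ∀ j → f (toℕ (punchIn i j)) ≡ 0ᵣ
      rest≡0 j = f≡0 _ (Fin.toℕ<n (punchIn i j))
        (λ e → Fin.punchInᵢ≢i i j (Fin.toℕ-injective (trans e (sym (Fin.toℕ-fromℕ< a<N)))))

  ∑bit≤-cong : ∀ m {f h : Bool → ℕ → ℝ} → (∀ b g → g ≤ m → f b g ≡ h b g) → ∑bit≤ m f ≡ ∑bit≤ m h
  ∑bit≤-cong m f≡h = cong₂ _+_ (∑<-cong (suc m) (λ g → f≡h false g ∘ ℕ.≤-pred))
                               (∑<-cong (suc m) (λ g → f≡h true g ∘ ℕ.≤-pred))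

  ∑bit≤-zero : ∀ m {f : Bool → ℕ → ℝ} → (∀ b g → g ≤ m → f b g ≡ 0ᵣ) → ∑bit≤ m f ≡ 0ᵣ
  ∑bit≤-zero m f≡0 = trans (cong₂ _+_ (∑<-zero (suc m) (λ g → f≡0 false g ∘ ℕ.≤-pred))
                                      (∑<-zero (suc m) (λ g → f≡0 true g ∘ ℕ.≤-pred)))
                           (+-identityˡ 0ᵣ)

  ∑bit≤-+ : ∀ m (f h : Bool → ℕ → ℝ) → ∑bit≤ m (λ b g → f b g + h b g) ≡ ∑bit≤ m f + ∑bit≤ m h
  ∑bit≤-+ m f h = trans (cong₂ _+_ (∑<-+ (suc m) (f false) (h false)) (∑<-+ (suc m) (f true) (h true)))
    (solve 4 (λ a b c d → (a :+ b) :+ (c :+ d) := (a :+ c) :+ (b :+ d)) refl _ _ _ _)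

  ∑bit≤-*ˡ : ∀ m c (f : Bool → ℕ → ℝ) → ∑bit≤ m (λ b g → c * f b g) ≡ c * ∑bit≤ m f
  ∑bit≤-*ˡ m c f = trans (cong₂ _+_ (∑<-*ˡ (suc m) c (f false)) (∑<-*ˡ (suc m) c (f true)))
    (solve 3 (λ c a b → c :* a :+ c :* b := c :* (a :+ b)) refl _ _ _)

  ∑bit≤-single : ∀ m b₀ g₀ (f : Bool → ℕ → ℝ) → g₀ ≤ m →
                 (∀ b g → g ≤ m → (b , g) ≢ (b₀ , g₀) → f b g ≡ 0ᵣ) → ∑bit≤ m f ≡ f b₀ g₀
  ∑bit≤-single m false g₀ f g₀≤m f≡0 = trans
    (cong₂ _+_ (∑<-single g₀ (f false) (s≤s g₀≤m) (λ g g<1+m g≢g₀ → f≡0 false g (ℕ.≤-pred g<1+m) (g≢g₀ ∘ cong proj₂)))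
               (∑<-zero (suc m) (λ g g<1+m → f≡0 true g (ℕ.≤-pred g<1+m) (λ ()))))
    (+-identityʳ _)
  ∑bit≤-single m true g₀ f g₀≤m f≡0 = trans
    (cong₂ _+_ (∑<-zero (suc m) (λ g g<1+m → f≡0 false g (ℕ.≤-pred g<1+m) (λ ())))
               (∑<-single g₀ (f true) (s≤s g₀≤m) (λ g g<1+m g≢g₀ → f≡0 true g (ℕ.≤-pred g<1+m) (g≢g₀ ∘ cong proj₂))))
    (+-identityˡ _)

module CubeDerivatives (Rf : RealField) where
  open RealField Rf
  open Poly Rf
  open FieldFacts Rf

  falling : ℕ → ℕ → ℝ
  falling a zero    = 1ᵣ
  falling a (suc g) = falling a g * fromℕ (a ∸ g)

  fallingᵛ : ∀ {n} → Vec ℕ n → Vec ℕ n → ℝ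
  fallingᵛ []      []      = 1ᵣ
  fallingᵛ (a ∷ α) (g ∷ γ) = falling a g * fallingᵛ α γ

  ∂ᵗ : ∀ {n} → Vec ℕ n → ℝ × Monomial n → ℝ × Monomial n
  ∂ᵗ γ (c , α) = c * fallingᵛ α γ , zipWith _∸_ α γ

  ∂ᵛ : ∀ {n} → Vec ℕ n → Polynomial n → Polynomial n
  ∂ᵛ γ = List.map (∂ᵗ γ)

  multiIndex : ∀ {n} → List (Fin n) → Vec ℕ n
  multiIndex []       = replicate _ 0
  multiIndex (i ∷ is) = updateAt (multiIndex is) i suc

  ∂ᵗ-zero : ∀ {n} (t : ℝ × Monomial n) → ∂ᵗ (replicate n 0) t ≡ t
  ∂ᵗ-zero (c , α) = cong₂ _,_ (trans (cong (c *_) (fallingᵛ-zero α)) (*-identityʳ c))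
                              (trans (Vec.zipWith-replicate₂ _∸_ α 0) (Vec.map-id α))
    where
      fallingᵛ-zero : ∀ {n} (α : Vec ℕ n) → fallingᵛ α (replicate n 0) ≡ 1ᵣ
      fallingᵛ-zero []      = refl
      fallingᵛ-zero (a ∷ α) = trans (*-identityˡ _) (fallingᵛ-zero α)

  ∂ᵗ-suc : ∀ {n} (i : Fin n) γ (t : ℝ × Monomial n) → let (c , α) = ∂ᵗ γ t in
           (c * fromℕ (lookup α i) , updateAt α i (_∸ 1)) ≡ ∂ᵗ (updateAt γ i suc) t
  ∂ᵗ-suc i γ (c , α) = cong₂ _,_
      (trans (*-assoc c _ _) (cong (c *_) (fallingᵛ-suc α γ i)))
      (∸-updateAt α γ i)
    where
      fallingᵛ-suc : ∀ {n} (α γ : Vec ℕ n) i →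
                     fallingᵛ α γ * fromℕ (lookup (zipWith _∸_ α γ) i) ≡ fallingᵛ α (updateAt γ i suc)
      fallingᵛ-suc (a ∷ α) (g ∷ γ) Fin.zero    = solve 3 (λ x y z → (x :* y) :* z := (x :* z) :* y) refl _ _ _
      fallingᵛ-suc (a ∷ α) (g ∷ γ) (Fin.suc i) = trans (*-assoc _ _ _) (cong (falling a g *_) (fallingᵛ-suc α γ i))
      ∸-updateAt : ∀ {n} (α γ : Vec ℕ n) i →
                   updateAt (zipWith _∸_ α γ) i (_∸ 1) ≡ zipWith _∸_ α (updateAt γ i suc)
      ∸-updateAt (a ∷ α) (g ∷ γ) Fin.zero    = cong (_∷ zipWith _∸_ α γ) (trans (ℕ.∸-+-assoc a g 1) (cong (a ∸_) (ℕ.+-comm g 1)))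
      ∸-updateAt (a ∷ α) (g ∷ γ) (Fin.suc i) = cong (_ ∷_) (∸-updateAt α γ i)

  ∂*≡∂ᵛ : ∀ {n} (is : List (Fin n)) P → ∂* is P ≡ ∂ᵛ (multiIndex is) P
  ∂*≡∂ᵛ []       P = sym (trans (List.map-cong ∂ᵗ-zero P) (List.map-id P))
  ∂*≡∂ᵛ (i ∷ is) P = trans (cong (∂ i) (∂*≡∂ᵛ is P)) (∂-∂ᵛ P)
    where
      ∂-∂ᵛ : ∀ P → ∂ i (∂ᵛ (multiIndex is) P) ≡ ∂ᵛ (multiIndex (i ∷ is)) P
      ∂-∂ᵛ []      = refl
      ∂-∂ᵛ (t ∷ P) = cong₂ _∷_ (∂ᵗ-suc i (multiIndex is) t) (∂-∂ᵛ P)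

  length≡sum-multiIndex : ∀ {n} (is : List (Fin n)) → length is ≡ Vec.sum (multiIndex is)
  length≡sum-multiIndex {n} [] = sym (sum-zeros n)
    where
      sum-zeros : ∀ n → Vec.sum (replicate n 0) ≡ 0
      sum-zeros zero    = refl
      sum-zeros (suc n) = sum-zeros n
  length≡sum-multiIndex (i ∷ is) = trans (cong suc (length≡sum-multiIndex is)) (sym (sum-updateAt-suc (multiIndex is) i))
    where
      sum-updateAt-suc : ∀ {n} (v : Vec ℕ n) i → Vec.sum (updateAt v i suc) ≡ suc (Vec.sum v)
      sum-updateAt-suc (x ∷ v) Fin.zero    = refl
      sum-updateAt-suc (x ∷ v) (Fin.suc i) = trans (cong (x ℕ.+_) (sum-updateAt-suc v i)) (ℕ.+-suc x _)

  indexList : ∀ {n} → Vec ℕ n → List (Fin n)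
  indexList []      = []
  indexList (g ∷ γ) = List.replicate g Fin.zero List.++ List.map Fin.suc (indexList γ)

  multiIndex-indexList : ∀ {n} (γ : Vec ℕ n) → multiIndex (indexList γ) ≡ γ
  multiIndex-indexList []      = refl
  multiIndex-indexList (g ∷ γ) = trans (multiIndex-zeros g _) (cong₂ _∷_ (ℕ.+-identityʳ g) (multiIndex-indexList γ))
    where
      multiIndex-suc : ∀ {n} (is : List (Fin n)) → multiIndex (List.map Fin.suc is) ≡ 0 ∷ multiIndex is
      multiIndex-suc []       = refl
      multiIndex-suc (i ∷ is) = cong (λ v → updateAt v (Fin.suc i) suc) (multiIndex-suc is)
      multiIndex-zeros : ∀ {n} g (is : List (Fin n)) →
                         multiIndex (List.replicate g Fin.zero List.++ List.map Fin.suc is) ≡ g ℕ.+ 0 ∷ multiIndex is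
      multiIndex-zeros zero    is = multiIndex-suc is
      multiIndex-zeros (suc g) is = cong (λ v → updateAt v Fin.zero suc) (multiIndex-zeros g is)

  length-indexList : ∀ {n} (γ : Vec ℕ n) → length (indexList γ) ≡ Vec.sum γ
  length-indexList γ = trans (length≡sum-multiIndex (indexList γ)) (cong Vec.sum (multiIndex-indexList γ))

  ZeroMultAtLeast⇒∂ᵛ≡0 : ∀ {n} {P : Polynomial n} {s x} → ZeroMultAtLeast P s x →
                         ∀ γ → Vec.sum γ < s → eval (∂ᵛ γ P) x ≡ 0ᵣ
  ZeroMultAtLeast⇒∂ᵛ≡0 {P = P} {s} {x} zero-at-x γ |γ|<s = begin
      eval (∂ᵛ γ P) x                           ≡⟨ cong (λ δ → eval (∂ᵛ δ P) x) (sym (multiIndex-indexList γ)) ⟩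
      eval (∂ᵛ (multiIndex (indexList γ)) P) x  ≡⟨ cong (λ Q → eval Q x) (sym (∂*≡∂ᵛ (indexList γ) P)) ⟩
      eval (∂* (indexList γ) P) x               ≡⟨ zero-at-x (indexList γ) (subst (_< s) (sym (length-indexList γ)) |γ|<s) ⟩
      0ᵣ                                        ∎
    where open ≡-Reasoning

  ZeroMultAtLeast-suc : ∀ {n} {P : Polynomial n} {s x} → ZeroMultAtLeast P s x →
                        (∀ γ → Vec.sum γ ≡ s → eval (∂ᵛ γ P) x ≡ 0ᵣ) → ZeroMultAtLeast P (suc s) x
  ZeroMultAtLeast-suc {P = P} {s} {x} below order-s is |is|<1+s with length is ℕ.<? s
  ... | yes |is|<s = below is |is|<s
  ... | no  |is|≮s = trans (cong (λ Q → eval Q x) (∂*≡∂ᵛ is P)) (order-s (multiIndex is) |γ|≡s)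
    where
      |γ|≡s : Vec.sum (multiIndex is) ≡ s
      |γ|≡s = trans (sym (length≡sum-multiIndex is)) (ℕ.≤-antisym (ℕ.≤-pred |is|<1+s) (ℕ.≮⇒≥ |is|≮s))

  bit : Bool → ℝ
  bit b = if b then 1ᵣ else 0ᵣ

  -- the g-th derivative of x^a at x = b
  powDeriv : ℕ → ℕ → Bool → ℝ
  powDeriv a g b = falling a g * bit b ^ (a ∸ g)

  monoDeriv : ∀ {n} → Monomial n → Vec ℕ n → Vec Bool n → ℝ
  monoDeriv []      []      []      = 1ᵣ
  monoDeriv (a ∷ α) (g ∷ γ) (b ∷ u) = powDeriv a g b * monoDeriv α γ u

  eval-∂ᵛ-cubePoint : ∀ {n} γ c α (P : Polynomial n) u →
    eval (∂ᵛ γ ((c , α) ∷ P)) (cubePoint u) ≡ c * monoDeriv α γ u + eval (∂ᵛ γ P) (cubePoint u)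
  eval-∂ᵛ-cubePoint γ c α P u =
    cong (_+ eval (∂ᵛ γ P) (cubePoint u)) (trans (*-assoc c _ _) (cong (c *_) (fallingᵛ*evalMono α γ u)))
    where
      fallingᵛ*evalMono : ∀ {n} (α γ : Vec ℕ n) u →
                          fallingᵛ α γ * evalMono (zipWith _∸_ α γ) (cubePoint u) ≡ monoDeriv α γ u
      fallingᵛ*evalMono []      []      []      = *-identityˡ 1ᵣ
      fallingᵛ*evalMono (a ∷ α) (g ∷ γ) (b ∷ u) = trans
        (solve 4 (λ x y z w → (x :* y) :* (z :* w) := (x :* z) :* (y :* w)) refl
               (falling a g) (fallingᵛ α γ) (bit b ^ (a ∸ g)) (evalMono (zipWith _∸_ α γ) (cubePoint u)))
        (cong (powDeriv a g b *_) (fallingᵛ*evalMono α γ u))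

module Pairing (Rf : RealField) where
  open RealField Rf
  open Poly Rf
  open FieldFacts Rf

  ⟪_,_⟫ : ∀ {n} → Polynomial n → (Monomial n → ℝ) → ℝ
  ⟪ []          , W ⟫ = 0ᵣ
  ⟪ (c , α) ∷ P , W ⟫ = c * W α + ⟪ P , W ⟫

  private
    _≟ᵐ_ : ∀ {n} (α β : Monomial n) → Dec (α ≡ β)
    _≟ᵐ_ = Vec.≡-dec ℕ._≟_

  coeff-∷-≢ : ∀ {n} c {α β : Monomial n} P → α ≢ β → coeff ((c , α) ∷ P) β ≡ coeff P β
  coeff-∷-≢ c {α} {β} P α≢β with α ≟ᵐ β
  ... | yes α≡β = ⊥-elim (α≢β α≡β)
  ... | no  _   = refl

  without : ∀ {n} → Monomial n → Polynomial n → Polynomial n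
  without α₀ []            = []
  without α₀ ((c , α) ∷ P) with α ≟ᵐ α₀
  ... | yes _ = without α₀ P
  ... | no  _ = (c , α) ∷ without α₀ P

  length-without : ∀ {n} (α₀ : Monomial n) P → length (without α₀ P) ≤ length P
  length-without α₀ []            = z≤n
  length-without α₀ ((c , α) ∷ P) with α ≟ᵐ α₀
  ... | yes _ = ℕ.m≤n⇒m≤1+n (length-without α₀ P)
  ... | no  _ = s≤s (length-without α₀ P)

  coeff-without-≡ : ∀ {n} (α₀ : Monomial n) P → coeff (without α₀ P) α₀ ≡ 0ᵣ
  coeff-without-≡ α₀ []            = refl
  coeff-without-≡ α₀ ((c , α) ∷ P) with α ≟ᵐ α₀
  ... | yes _   = coeff-without-≡ α₀ P
  ... | no  α≢ = trans (coeff-∷-≢ c (without α₀ P) α≢) (coeff-without-≡ α₀ P)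

  coeff-without-≢ : ∀ {n} {α₀ β : Monomial n} P → β ≢ α₀ → coeff (without α₀ P) β ≡ coeff P β
  coeff-without-≢ []            β≢α₀ = refl
  coeff-without-≢ {α₀ = α₀} {β} ((c , α) ∷ P) β≢α₀ with α ≟ᵐ α₀
  ... | yes refl = trans (coeff-without-≢ P β≢α₀) (sym (coeff-∷-≢ c P (β≢α₀ ∘ sym)))
  ... | no  _ with α ≟ᵐ β
  ...   | yes _ = cong (c +_) (coeff-without-≢ P β≢α₀)
  ...   | no  _ = coeff-without-≢ P β≢α₀

  ⟪⟫-without : ∀ {n} (α₀ : Monomial n) P W → ⟪ P , W ⟫ ≡ coeff P α₀ * W α₀ + ⟪ without α₀ P , W ⟫
  ⟪⟫-without α₀ []            W = sym (trans (cong (_+ 0ᵣ) (zeroˡ (W α₀))) (+-identityˡ 0ᵣ))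
  ⟪⟫-without α₀ ((c , α) ∷ P) W with α ≟ᵐ α₀
  ... | yes refl = trans (cong (c * W α +_) (⟪⟫-without α P W))
      (solve 4 (λ c d w r → c :* w :+ (d :* w :+ r) := (c :+ d) :* w :+ r) refl c (coeff P α) (W α) _)
  ... | no  _    = trans (cong (c * W α +_) (⟪⟫-without α₀ P W))
      (solve 3 (λ x y z → x :+ (y :+ z) := y :+ (x :+ z)) refl (c * W α) (coeff P α₀ * W α₀) _)

  -- Group the terms by monomial: those of the head monomial at once, then recurse.
  ⟪⟫≡0 : ∀ {n} (P : Polynomial n) W → (∀ α → coeff P α ≡ 0ᵣ ⊎ W α ≡ 0ᵣ) → ⟪ P , W ⟫ ≡ 0ᵣ
  ⟪⟫≡0 P W = go (length P) P ℕ.≤-refl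
    where
      go : ∀ N P → length P ≤ N → (∀ α → coeff P α ≡ 0ᵣ ⊎ W α ≡ 0ᵣ) → ⟪ P , W ⟫ ≡ 0ᵣ
      go _       []             _          _        = refl
      go (suc N) ((c , α₀) ∷ P) (s≤s |P|≤N) coeff≡0∨W≡0 = begin
          ⟪ (c , α₀) ∷ P , W ⟫                                     ≡⟨ ⟪⟫-without α₀ ((c , α₀) ∷ P) W ⟩
          coeff Q α₀ * W α₀ + ⟪ without α₀ Q , W ⟫                 ≡⟨ cong₂ _+_ first (go N (without α₀ Q) |Q'|≤N rest) ⟩
          0ᵣ + 0ᵣ                                                  ≡⟨ +-identityˡ 0ᵣ ⟩
          0ᵣ                                                       ∎
        where
          open ≡-Reasoning
          Q = (c , α₀) ∷ P
          |Q'|≤N : length (without α₀ Q) ≤ N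
          |Q'|≤N with α₀ ≟ᵐ α₀
          ... | yes _ = ℕ.≤-trans (length-without α₀ P) |P|≤N
          ... | no α₀≢α₀ = ⊥-elim (α₀≢α₀ refl)
          first : coeff Q α₀ * W α₀ ≡ 0ᵣ
          first with coeff≡0∨W≡0 α₀
          ... | inj₁ coeff≡0 = trans (cong (_* W α₀) coeff≡0) (zeroˡ _)
          ... | inj₂ W≡0     = trans (cong (coeff Q α₀ *_) W≡0) (zeroʳ _)
          rest : ∀ α → coeff (without α₀ Q) α ≡ 0ᵣ ⊎ W α ≡ 0ᵣ
          rest α with α ≟ᵐ α₀
          ... | yes refl = inj₁ (coeff-without-≡ α₀ Q)
          ... | no  α≢α₀ with coeff≡0∨W≡0 α
          ...   | inj₁ coeff≡0 = inj₁ (trans (coeff-without-≢ Q α≢α₀) coeff≡0)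
          ...   | inj₂ W≡0     = inj₂ W≡0

module BooleanVectors where
  open import Data.Bool using (f≤t; b≤b) renaming (_≤_ to _≤ᵇ_)

  differs : Bool → Bool → ℕ
  differs true  true  = 0
  differs false false = 0
  differs _     _     = 1

  mismatches : ∀ {n} → Bool → Vec Bool n → ℕ
  mismatches L []      = 0
  mismatches L (c ∷ v) = differs L c ℕ.+ mismatches L v

  mismatches-true : ∀ {n} (v : Vec Bool n) → mismatches true v ℕ.+ Vec.count (_≟ᵇ true) v ≡ n
  mismatches-true []          = refl
  mismatches-true (true ∷ v)  = trans (ℕ.+-suc _ _) (cong suc (mismatches-true v))
  mismatches-true (false ∷ v) = cong suc (mismatches-true v)

  mismatches-false : ∀ {n} (v : Vec Bool n) → mismatches false v ≡ Vec.count (_≟ᵇ true) v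
  mismatches-false []          = refl
  mismatches-false (true ∷ v)  = cong suc (mismatches-false v)
  mismatches-false (false ∷ v) = mismatches-false v

  mismatches-⊔ : ∀ {n} (v : Vec Bool n) → let k = Vec.count (_≟ᵇ true) v in
                 Σ Bool (λ L → mismatches L v ≡ k ℕ.⊔ (n ∸ k))
  mismatches-⊔ {n} v with Vec.count (_≟ᵇ true) v ℕ.≤? n ∸ Vec.count (_≟ᵇ true) v
  ... | yes k≤n-k = true , (begin
        mismatches true v            ≡⟨ sym (ℕ.m+n∸n≡m (mismatches true v) k) ⟩
        mismatches true v ℕ.+ k ∸ k  ≡⟨ cong (_∸ k) (mismatches-true v) ⟩
        n ∸ k                        ≡⟨ sym (ℕ.m≤n⇒m⊔n≡n k≤n-k) ⟩
        k ℕ.⊔ (n ∸ k)                ∎)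
    where
      open ≡-Reasoning
      k : ℕ
      k = Vec.count (_≟ᵇ true) v
  ... | no  k≰n-k = false , trans (mismatches-false v) (sym (ℕ.m≥n⇒m⊔n≡m (ℕ.≰⇒≥ k≰n-k)))

  count-true-≤ : ∀ {n} {u v : Vec Bool n} → Pointwise _≤ᵇ_ u v → Vec.count (_≟ᵇ true) u ℕ.≤ Vec.count (_≟ᵇ true) v
  count-true-≤ []                = z≤n
  count-true-≤ (f≤t         ∷ u≤v) = ℕ.m≤n⇒m≤1+n (count-true-≤ u≤v)
  count-true-≤ (b≤b {true}  ∷ u≤v) = s≤s (count-true-≤ u≤v)
  count-true-≤ (b≤b {false} ∷ u≤v) = count-true-≤ u≤v

  count-true-≡⇒≡ : ∀ {n} {u v : Vec Bool n} → Pointwise _≤ᵇ_ u v →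
                   Vec.count (_≟ᵇ true) u ≡ Vec.count (_≟ᵇ true) v → u ≡ v
  count-true-≡⇒≡ []                  _ = refl
  count-true-≡⇒≡ (f≤t         ∷ u≤v) e = ⊥-elim (ℕ.<⇒≢ (s≤s (count-true-≤ u≤v)) e)
  count-true-≡⇒≡ (b≤b {true}  ∷ u≤v) e = cong (true ∷_) (count-true-≡⇒≡ u≤v (ℕ.suc-injective e))
  count-true-≡⇒≡ (b≤b {false} ∷ u≤v) e = cong (false ∷_) (count-true-≡⇒≡ u≤v e)

  KeepsEntries : ∀ {n} → Bool → Vec Bool n → Vec Bool n → Set
  KeepsEntries L = Pointwise (λ b c → c ≡ L → b ≡ L)

  KeepsEntries∧count-true-≡⇒≡ : ∀ {n} L {u v : Vec Bool n} → KeepsEntries L u v →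
                                Vec.count (_≟ᵇ true) u ≡ Vec.count (_≟ᵇ true) v → u ≡ v
  KeepsEntries∧count-true-≡⇒≡ true  keeps e = sym (count-true-≡⇒≡ (Pointwise.sym c≤b keeps) (sym e))
    where
      c≤b : ∀ {b c} → (c ≡ true → b ≡ true) → c ≤ᵇ b
      c≤b {true}  {false} _ = f≤t
      c≤b {true}  {true}  _ = b≤b
      c≤b {false} {false} _ = b≤b
      c≤b {false} {true}  h with () ← h refl
  KeepsEntries∧count-true-≡⇒≡ false keeps e = count-true-≡⇒≡ (Pointwise.map b≤c keeps) e
    where
      b≤c : ∀ {b c} → (c ≡ false → b ≡ false) → b ≤ᵇ c
      b≤c {false} {true}  _ = f≤t
      b≤c {false} {false} _ = b≤b
      b≤c {true}  {true}  _ = b≤b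
      b≤c {true}  {false} h with () ← h refl

  count-true-any : ∀ {n k} → k ≤ n → Σ (Vec Bool n) (λ v → Vec.count (_≟ᵇ true) v ≡ k)
  count-true-any {zero}  {zero}  _         = [] , refl
  count-true-any {suc n} {zero}  _         = let v , e = count-true-any z≤n in false ∷ v , e
  count-true-any {suc n} {suc k} (s≤s k≤n) = let v , e = count-true-any k≤n in true ∷ v , cong suc e

module UnivariateDuals (Rf : RealField) where
  open RealField Rf
  open Poly Rf
  open FieldFacts Rf
  open FiniteSums Rf
  open CubeDerivatives Rf
  open BooleanVectors using (differs)

  falling-zero : ∀ {a g} → a < g → falling a g ≡ 0ᵣ
  falling-zero {a} {suc g} (s≤s a≤g) with ℕ.m≤n⇒m<n∨m≡n a≤g
  ... | inj₁ a<g  = trans (cong (_* fromℕ (a ∸ g)) (falling-zero a<g)) (zeroˡ _)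
  ... | inj₂ refl = trans (cong (λ d → falling a a * fromℕ d) (ℕ.n∸n≡0 a)) (zeroʳ _)

  falling-≢0 : ∀ {a g} → g ≤ a → falling a g ≢ 0ᵣ
  falling-≢0 {a} {zero}  _   = 1≢0
  falling-≢0 {a} {suc g} g<a = *-≢0 (falling-≢0 (ℕ.<⇒≤ g<a))
    (subst (λ d → fromℕ d ≢ 0ᵣ) (sym (ℕ.+-∸-assoc 1 g<a)) (fromℕ-suc-≢0 (a ∸ suc g)))

  falling-suc : ∀ a g → falling a (suc g) ≡ (fromℕ a + - fromℕ g) * falling a g
  falling-suc a g with g ℕ.≤? a
  ... | yes g≤a = trans (cong (falling a g *_) (fromℕ-∸ g≤a)) (*-comm _ _)
  ... | no  g≰a = begin
      falling a g * fromℕ (a ∸ g)            ≡⟨ cong (_* fromℕ (a ∸ g)) a<g⇒0 ⟩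
      0ᵣ * fromℕ (a ∸ g)                     ≡⟨ zeroˡ _ ⟩
      0ᵣ                                     ≡⟨ sym (zeroʳ _) ⟩
      (fromℕ a + - fromℕ g) * 0ᵣ             ≡⟨ cong ((fromℕ a + - fromℕ g) *_) (sym a<g⇒0) ⟩
      (fromℕ a + - fromℕ g) * falling a g    ∎
    where
      open ≡-Reasoning
      a<g⇒0 : falling a g ≡ 0ᵣ
      a<g⇒0 = falling-zero (ℕ.≰⇒> g≰a)

  factorial⁻¹ : ℕ → ℝ
  factorial⁻¹ a = proj₁ (inverse (falling a a) (falling-≢0 {a} ℕ.≤-refl))

  falling*factorial⁻¹ : ∀ a → falling a a * factorial⁻¹ a ≡ 1ᵣ
  falling*factorial⁻¹ a = proj₂ (inverse (falling a a) (falling-≢0 {a} ℕ.≤-refl))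

  powDeriv-true : ∀ a g → powDeriv a g true ≡ falling a g
  powDeriv-true a g = trans (cong (falling a g *_) (1^ (a ∸ g))) (*-identityʳ _)
    where
      1^ : ∀ k → 1ᵣ ^ k ≡ 1ᵣ
      1^ zero    = refl
      1^ (suc k) = trans (*-identityˡ _) (1^ k)

  powDeriv-false-≢ : ∀ {a g} → g ≢ a → powDeriv a g false ≡ 0ᵣ
  powDeriv-false-≢ {a} {g} g≢a with ℕ.<-cmp g a
  ... | tri< g<a _ _ = trans (cong (λ d → falling a g * (0ᵣ ^ d)) (ℕ.+-∸-assoc 1 g<a))
                             (trans (cong (falling a g *_) (zeroˡ _)) (zeroʳ _))
  ... | tri≈ _ g≡a _ = ⊥-elim (g≢a g≡a)
  ... | tri> _ _ g>a = trans (cong (_* (0ᵣ ^ (a ∸ g))) (falling-zero g>a)) (zeroˡ _)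

  powDeriv-false-≡ : ∀ a → powDeriv a a false ≡ falling a a
  powDeriv-false-≡ a = trans (cong (λ d → falling a a * (0ᵣ ^ d)) (ℕ.n∸n≡0 a)) (*-identityʳ _)

  ffEval : ℕ → List ℝ → ℕ → ℝ
  ffEval g []       a = 0ᵣ
  ffEval g (c ∷ cs) a = c * falling a g + ffEval (suc g) cs a

  -- Multiplication by x - s in the falling-factorial basis, via (x - s)(x)_g = (x)_{g+1} + (g - s)(x)_g.
  mulLinear : ℕ → ℝ → ℝ → List ℝ → List ℝ
  mulLinear g s p []       = p ∷ []
  mulLinear g s p (c ∷ cs) = (p + (fromℕ g + - s) * c) ∷ mulLinear (suc g) s c cs

  ffEval-mulLinear : ∀ g s p cs a →
    ffEval g (mulLinear g s p cs) a ≡ p * falling a g + (fromℕ a + - s) * ffEval g cs a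
  ffEval-mulLinear g s p []       a = cong (p * falling a g +_) (sym (zeroʳ _))
  ffEval-mulLinear g s p (c ∷ cs) a = begin
      (p + (G + S) * c) * F + ffEval (suc g) (mulLinear (suc g) s c cs) a
        ≡⟨ cong ((p + (G + S) * c) * F +_) (ffEval-mulLinear (suc g) s c cs a) ⟩
      (p + (G + S) * c) * F + (c * falling a (suc g) + (X + S) * E)
        ≡⟨ cong (λ f → (p + (G + S) * c) * F + (c * f + (X + S) * E)) (falling-suc a g) ⟩
      (p + (G + S) * c) * F + (c * ((X + - G) * F) + (X + S) * E)
        ≡⟨ solve 8 (λ p G S c F X G⁻ E →
             (p :+ (G :+ S) :* c) :* F :+ (c :* ((X :+ G⁻) :* F) :+ (X :+ S) :* E)
             := p :* F :+ (X :+ S) :* (c :* F :+ E) :+ (G :+ G⁻) :* (c :* F)) refl p G S c F X (- G) E ⟩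
      p * F + (X + S) * (c * F + E) + (G + - G) * (c * F)
        ≡⟨ cong (λ z → p * F + (X + S) * (c * F + E) + z * (c * F)) (-‿inverseʳ G) ⟩
      p * F + (X + S) * (c * F + E) + 0ᵣ * (c * F)
        ≡⟨ trans (cong (p * F + (X + S) * (c * F + E) +_) (zeroˡ (c * F))) (+-identityʳ _) ⟩
      p * F + (X + S) * (c * F + E) ∎
    where
      open ≡-Reasoning
      G S F X E : ℝ
      G = fromℕ g
      S = - s
      F = falling a g
      X = fromℕ a
      E = ffEval (suc g) cs a

  coeffAt : List ℝ → ℕ → ℝ
  coeffAt []       _       = 0ᵣ
  coeffAt (c ∷ cs) zero    = c
  coeffAt (c ∷ cs) (suc g) = coeffAt cs g

  coeffAt-beyond : ∀ cs {g} → length cs ≤ g → coeffAt cs g ≡ 0ᵣ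
  coeffAt-beyond []       _         = refl
  coeffAt-beyond (c ∷ cs) (s≤s |cs|≤g) = coeffAt-beyond cs |cs|≤g

  length-mulLinear : ∀ g s p cs → length (mulLinear g s p cs) ≡ suc (length cs)
  length-mulLinear g s p []       = refl
  length-mulLinear g s p (c ∷ cs) = cong suc (length-mulLinear (suc g) s c cs)

  coeffAt-mulLinear-top : ∀ g s p cs → coeffAt (mulLinear g s p cs) (length cs) ≡ coeffAt (p ∷ cs) (length cs)
  coeffAt-mulLinear-top g s p []       = refl
  coeffAt-mulLinear-top g s p (c ∷ cs) = coeffAt-mulLinear-top (suc g) s c cs

  ffEval≡∑< : ∀ cs N a → length cs ≤ N → ∑< N (λ g → coeffAt cs g * falling a g) ≡ ffEval 0 cs a
  ffEval≡∑< cs N a = go 0 cs N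
    where
      go : ∀ g₀ cs N → length cs ≤ N → ∑< N (λ g → coeffAt cs g * falling a (g₀ ℕ.+ g)) ≡ ffEval g₀ cs a
      go g₀ []       N       _         = ∑<-zero N (λ g _ → zeroˡ (falling a (g₀ ℕ.+ g)))
      go g₀ (c ∷ cs) (suc N) (s≤s |cs|≤N) = cong₂ _+_
        (cong (λ g → c * falling a g) (ℕ.+-identityʳ g₀))
        (trans (∑<-cong N (λ g _ → cong (λ h → coeffAt cs g * falling a h) (ℕ.+-suc g₀ g))) (go (suc g₀) cs N |cs|≤N))

  rootProduct : ℕ → ℕ → ℕ → ℝ
  rootProduct z zero    a = 1ᵣ
  rootProduct z (suc r) a = (fromℕ a + - fromℕ (z ℕ.+ r)) * rootProduct z r a

  rootProduct-root : ∀ {z r a} → z ≤ a → a < z ℕ.+ r → rootProduct z r a ≡ 0ᵣ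
  rootProduct-root {z} {zero}  {a} z≤a a<z+0 = ⊥-elim (ℕ.<⇒≱ a<z+0 (subst (_≤ a) (sym (ℕ.+-identityʳ z)) z≤a))
  rootProduct-root {z} {suc r} {a} z≤a a<z+1+r with ℕ.m≤n⇒m<n∨m≡n (ℕ.≤-pred (subst (suc a ≤_) (ℕ.+-suc z r) a<z+1+r))
  ... | inj₁ a<z+r = trans (cong ((fromℕ a + - fromℕ (z ℕ.+ r)) *_) (rootProduct-root z≤a a<z+r)) (zeroʳ _)
  ... | inj₂ refl  = trans (cong (_* rootProduct z r a) (-‿inverseʳ (fromℕ a))) (zeroˡ _)

  rootProduct-≢0 : ∀ {z r a} → a < z → rootProduct z r a ≢ 0ᵣ
  rootProduct-≢0 {z} {zero}  a<z = 1≢0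
  rootProduct-≢0 {z} {suc r} a<z = *-≢0
    (fromℕ-difference-≢0 (λ a≡z+r → ℕ.<⇒≱ a<z (subst (z ≤_) (sym a≡z+r) (ℕ.m≤m+n z r))))
    (rootProduct-≢0 {r = r} a<z)

  rootCoeffs : ℕ → ℕ → List ℝ
  rootCoeffs z zero    = 1ᵣ ∷ []
  rootCoeffs z (suc r) = mulLinear 0 (fromℕ (z ℕ.+ r)) 0ᵣ (rootCoeffs z r)

  ffEval-rootCoeffs : ∀ z r a → ffEval 0 (rootCoeffs z r) a ≡ rootProduct z r a
  ffEval-rootCoeffs z zero    a = trans (+-identityʳ _) (*-identityˡ 1ᵣ)
  ffEval-rootCoeffs z (suc r) a = begin
      ffEval 0 (mulLinear 0 s 0ᵣ (rootCoeffs z r)) a                  ≡⟨ ffEval-mulLinear 0 s 0ᵣ (rootCoeffs z r) a ⟩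
      0ᵣ * 1ᵣ + (fromℕ a + - s) * ffEval 0 (rootCoeffs z r) a          ≡⟨ cong₂ _+_ (zeroˡ 1ᵣ) (cong ((fromℕ a + - s) *_) (ffEval-rootCoeffs z r a)) ⟩
      0ᵣ + rootProduct z (suc r) a                                    ≡⟨ +-identityˡ _ ⟩
      rootProduct z (suc r) a                                         ∎
    where
      open ≡-Reasoning
      s : ℝ
      s = fromℕ (z ℕ.+ r)

  length-rootCoeffs : ∀ z r → length (rootCoeffs z r) ≡ suc r
  length-rootCoeffs z zero    = refl
  length-rootCoeffs z (suc r) = trans (length-mulLinear 0 _ 0ᵣ (rootCoeffs z r)) (cong suc (length-rootCoeffs z r))

  rootCoeffs-top : ∀ z r → coeffAt (rootCoeffs z r) r ≡ 1ᵣ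
  rootCoeffs-top z zero    = refl
  rootCoeffs-top z (suc r) = begin
      coeffAt (mulLinear 0 _ 0ᵣ cs) (suc r)        ≡⟨ cong (coeffAt (mulLinear 0 _ 0ᵣ cs)) (sym (length-rootCoeffs z r)) ⟩
      coeffAt (mulLinear 0 _ 0ᵣ cs) (length cs)    ≡⟨ coeffAt-mulLinear-top 0 _ 0ᵣ cs ⟩
      coeffAt (0ᵣ ∷ cs) (length cs)                ≡⟨ cong (coeffAt (0ᵣ ∷ cs)) (length-rootCoeffs z r) ⟩
      coeffAt cs r                                 ≡⟨ rootCoeffs-top z r ⟩
      1ᵣ                                           ∎
    where
      open ≡-Reasoning
      cs : List ℝ
      cs = rootCoeffs z r

  -- The functional f ↦ Σ_{b ∈ {0,1}, g ≤ m} μ b g · f⁽ᵍ⁾(b), evaluated at f = x^a.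
  applyToPower : ℕ → (Bool → ℕ → ℝ) → ℕ → ℝ
  applyToPower m μ a = ∑bit≤ m (λ b g → μ b g * powDeriv a g b)

  -- On x^a, the part at 1 gives p(a) for p = rootProduct z r (written in the falling-factorial basis),
  -- and the part at 0 gives -p(a) when a ≤ m.
  annihilator : ℕ → ℕ → Bool → ℕ → ℝ
  annihilator z r true  g = coeffAt (rootCoeffs z r) g
  annihilator z r false g = - (rootProduct z r g * factorial⁻¹ g)

  module _ (z r : ℕ) where
    private
      p : ℕ → ℝ
      p = rootProduct z r
      μ : Bool → ℕ → ℝ
      μ = annihilator z r

    annihilator-false-root : ∀ {g} → z ≤ g → g < z ℕ.+ r → μ false g ≡ 0ᵣ
    annihilator-false-root z≤g g<z+r =
      trans (cong (λ x → - (x * _)) (rootProduct-root z≤g g<z+r)) (trans (cong -_ (zeroˡ _)) -0#≈0#)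

    annihilator-false-≢0 : ∀ {g} → g < z → μ false g ≢ 0ᵣ
    annihilator-false-≢0 {g} g<z =
      -‿≢0 (*-≢0 (rootProduct-≢0 {r = r} g<z) (x*y≡1⇒y≢0 (falling*factorial⁻¹ g)))

    annihilator-true-beyond : ∀ {g} → r < g → μ true g ≡ 0ᵣ
    annihilator-true-beyond r<g = coeffAt-beyond (rootCoeffs z r) (subst (_≤ _) (sym (length-rootCoeffs z r)) r<g)

    annihilator-at-one : ∀ {m} a → r ≤ m → ∑< (suc m) (λ g → μ true g * powDeriv a g true) ≡ p a
    annihilator-at-one {m} a r≤m = begin
        ∑< (suc m) (λ g → μ true g * powDeriv a g true)   ≡⟨ ∑<-cong (suc m) (λ g _ → cong (μ true g *_) (powDeriv-true a g)) ⟩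
        ∑< (suc m) (λ g → μ true g * falling a g)         ≡⟨ ffEval≡∑< (rootCoeffs z r) (suc m) a |cs|≤1+m ⟩
        ffEval 0 (rootCoeffs z r) a                       ≡⟨ ffEval-rootCoeffs z r a ⟩
        p a                                               ∎
      where
        open ≡-Reasoning
        |cs|≤1+m : length (rootCoeffs z r) ≤ suc m
        |cs|≤1+m = subst (_≤ suc m) (sym (length-rootCoeffs z r)) (s≤s r≤m)

    annihilator-annihilates : ∀ {m a} → z ≤ suc m → r ≤ m → a < z ℕ.+ r → applyToPower m μ a ≡ 0ᵣ
    annihilator-annihilates {m} {a} z≤1+m r≤m a<z+r with a ℕ.≤? m
    ... | yes a≤m = trans (cong₂ _+_ atZero (annihilator-at-one a r≤m)) (-‿inverseˡ (p a))
      where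
        atZero : ∑< (suc m) (λ g → μ false g * powDeriv a g false) ≡ - p a
        atZero = begin
            ∑< (suc m) (λ g → μ false g * powDeriv a g false)
              ≡⟨ ∑<-single a _ (s≤s a≤m) (λ g _ g≢a → trans (cong (μ false g *_) (powDeriv-false-≢ g≢a)) (zeroʳ _)) ⟩
            - (p a * i) * powDeriv a a false       ≡⟨ cong (- (p a * i) *_) (powDeriv-false-≡ a) ⟩
            - (p a * i) * f                        ≡⟨ sym (-‿distribˡ-* (p a * i) f) ⟩
            - (p a * i * f)                        ≡⟨ cong -_ (solve 3 (λ x y z → x :* y :* z := x :* (z :* y)) refl (p a) i f) ⟩
            - (p a * (f * i))                      ≡⟨ cong (λ y → - (p a * y)) (falling*factorial⁻¹ a) ⟩
            - (p a * 1ᵣ)                           ≡⟨ cong -_ (*-identityʳ (p a)) ⟩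
            - p a                                  ∎
          where
            open ≡-Reasoning
            f i : ℝ
            f = falling a a
            i = factorial⁻¹ a
    ... | no a≰m = trans (cong₂ _+_ atZero (trans (annihilator-at-one a r≤m) (rootProduct-root z≤a a<z+r))) (+-identityˡ 0ᵣ)
      where
        z≤a : z ≤ a
        z≤a = ℕ.≤-trans z≤1+m (ℕ.≰⇒> a≰m)
        atZero : ∑< (suc m) (λ g → μ false g * powDeriv a g false) ≡ 0ᵣ
        atZero = ∑<-zero (suc m) (λ g g<1+m → trans (cong (μ false g *_)
          (powDeriv-false-≢ (λ g≡a → a≰m (subst (_≤ m) g≡a (ℕ.≤-pred g<1+m))))) (zeroʳ _))

  record UnivariateDual (L c : Bool) (m : ℕ) : Set where
    field
      μ           : Bool → ℕ → ℝ
      annihilates : ∀ a → a < m ℕ.+ m ℕ.+ differs L c → applyToPower m μ a ≡ 0ᵣ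
      μ-top-≢0    : μ c m ≢ 0ᵣ
      μ-top-not   : L ≡ c → μ (not c) m ≡ 0ᵣ

  private
    δ₀ : Bool → Bool → ℕ → ℝ
    δ₀ true  true  zero = 1ᵣ
    δ₀ false false zero = 1ᵣ
    δ₀ _     _     _    = 0ᵣ

  -- In each case z + r reaches the order with z ≤ m + 1 and r ≤ m, and the top weight on the side c is
  -- nonzero since m < z (side 0) or m = r (side 1).  For m = 0 and c = L nothing needs to be killed.
  univariateDual : ∀ L c m → UnivariateDual L c m
  univariateDual true true zero = record
    { μ = δ₀ true ; annihilates = λ _ () ; μ-top-≢0 = 1≢0 ; μ-top-not = λ _ → refl }
  univariateDual true true (suc m) = record
    { μ           = annihilator (suc m) (suc m)
    ; annihilates = λ a a<2m → annihilator-annihilates (suc m) (suc m) (ℕ.n≤1+n _) ℕ.≤-refl (subst (a <_) (ℕ.+-identityʳ _) a<2m)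
    ; μ-top-≢0    = λ 1≡0 → 1≢0 (trans (sym (rootCoeffs-top (suc m) (suc m))) 1≡0)
    ; μ-top-not   = λ _ → annihilator-false-root (suc m) (suc m) ℕ.≤-refl (ℕ.m<m+n (suc m) (s≤s z≤n))
    }
  univariateDual true false m = record
    { μ           = annihilator (suc m) m
    ; annihilates = λ a a<2m+1 → annihilator-annihilates (suc m) m ℕ.≤-refl ℕ.≤-refl (subst (a <_) (ℕ.+-comm (m ℕ.+ m) 1) a<2m+1)
    ; μ-top-≢0    = annihilator-false-≢0 (suc m) m ℕ.≤-refl
    ; μ-top-not   = λ ()
    }
  univariateDual false true m = record
    { μ           = annihilator (suc m) m
    ; annihilates = λ a a<2m+1 → annihilator-annihilates (suc m) m ℕ.≤-refl ℕ.≤-refl (subst (a <_) (ℕ.+-comm (m ℕ.+ m) 1) a<2m+1)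
    ; μ-top-≢0    = λ 1≡0 → 1≢0 (trans (sym (rootCoeffs-top (suc m) m)) 1≡0)
    ; μ-top-not   = λ ()
    }
  univariateDual false false zero = record
    { μ = δ₀ false ; annihilates = λ _ () ; μ-top-≢0 = 1≢0 ; μ-top-not = λ _ → refl }
  univariateDual false false (suc m) = record
    { μ           = annihilator (suc (suc m)) m
    ; annihilates = λ a a<2m → annihilator-annihilates (suc (suc m)) m ℕ.≤-refl (ℕ.n≤1+n m) (subst (a <_) (trans (ℕ.+-identityʳ _) (cong suc (ℕ.+-suc m m))) a<2m)
    ; μ-top-≢0    = annihilator-false-≢0 (suc (suc m)) m ℕ.≤-refl
    ; μ-top-not   = λ _ → annihilator-true-beyond (suc (suc m)) m ℕ.≤-refl
    }

module CubeFunctional (Rf : RealField) where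
  open RealField Rf
  open Poly Rf
  open FieldFacts Rf
  open FiniteSums Rf
  open CubeDerivatives Rf
  open Pairing Rf
  open UnivariateDuals Rf
  open BooleanVectors using (differs; mismatches; KeepsEntries)

  slice : ∀ {n} → (Vec Bool (suc n) → Vec ℕ (suc n) → ℝ) → Bool → ℕ → Vec Bool n → Vec ℕ n → ℝ
  slice F b g u γ = F (b ∷ u) (g ∷ γ)

  ∑box : ∀ {n} → Vec ℕ n → (Vec Bool n → Vec ℕ n → ℝ) → ℝ
  ∑box []      F = F [] []
  ∑box (m ∷ β) F = ∑bit≤ m (λ b g → ∑box β (slice F b g))

  ∑box-cong : ∀ {n} (β : Vec ℕ n) {F G : Vec Bool n → Vec ℕ n → ℝ} →
              (∀ u γ → Pointwise _≤_ γ β → F u γ ≡ G u γ) → ∑box β F ≡ ∑box β G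
  ∑box-cong []      F≡G = F≡G [] [] []
  ∑box-cong (m ∷ β) F≡G = ∑bit≤-cong m (λ b g g≤m → ∑box-cong β (λ u γ γ≤β → F≡G (b ∷ u) (g ∷ γ) (g≤m ∷ γ≤β)))

  ∑box-zero : ∀ {n} (β : Vec ℕ n) {F : Vec Bool n → Vec ℕ n → ℝ} →
              (∀ u γ → Pointwise _≤_ γ β → F u γ ≡ 0ᵣ) → ∑box β F ≡ 0ᵣ
  ∑box-zero []      F≡0 = F≡0 [] [] []
  ∑box-zero (m ∷ β) F≡0 = ∑bit≤-zero m (λ b g g≤m → ∑box-zero β (λ u γ γ≤β → F≡0 (b ∷ u) (g ∷ γ) (g≤m ∷ γ≤β)))

  ∑box-+ : ∀ {n} (β : Vec ℕ n) (F G : Vec Bool n → Vec ℕ n → ℝ) →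
           ∑box β (λ u γ → F u γ + G u γ) ≡ ∑box β F + ∑box β G
  ∑box-+ []      F G = refl
  ∑box-+ (m ∷ β) F G = trans (∑bit≤-cong m (λ b g _ → ∑box-+ β (slice F b g) (slice G b g)))
                             (∑bit≤-+ m (λ b g → ∑box β (slice F b g)) (λ b g → ∑box β (slice G b g)))

  ∑box-*ˡ : ∀ {n} (β : Vec ℕ n) c (F : Vec Bool n → Vec ℕ n → ℝ) → ∑box β (λ u γ → c * F u γ) ≡ c * ∑box β F
  ∑box-*ˡ []      c F = refl
  ∑box-*ˡ (m ∷ β) c F = trans (∑bit≤-cong m (λ b g _ → ∑box-*ˡ β c (slice F b g)))
                              (∑bit≤-*ˡ m c (λ b g → ∑box β (slice F b g)))

  ∑box-single : ∀ {n} (β : Vec ℕ n) u₀ γ₀ (F : Vec Bool n → Vec ℕ n → ℝ) → Pointwise _≤_ γ₀ β →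
                (∀ u γ → Pointwise _≤_ γ β → (u , γ) ≢ (u₀ , γ₀) → F u γ ≡ 0ᵣ) → ∑box β F ≡ F u₀ γ₀
  ∑box-single []      []        []        F []              _   = refl
  ∑box-single (m ∷ β) (b₀ ∷ u₀) (g₀ ∷ γ₀) F (g₀≤m ∷ γ₀≤β) F≡0 = trans
    (∑bit≤-single m b₀ g₀ _ g₀≤m (λ b g g≤m bg≢ → ∑box-zero β (λ u γ γ≤β →
      F≡0 (b ∷ u) (g ∷ γ) (g≤m ∷ γ≤β) (λ { refl → bg≢ refl }))))
    (∑box-single β u₀ γ₀ _ γ₀≤β (λ u γ γ≤β uγ≢ →
      F≡0 (b₀ ∷ u) (g₀ ∷ γ) (g₀≤m ∷ γ≤β) (λ { refl → uγ≢ refl })))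

  tensor : ∀ {n} → Vec (Bool → ℕ → ℝ) n → Vec Bool n → Vec ℕ n → ℝ
  tensor []       []      []      = 1ᵣ
  tensor (μ ∷ μs) (b ∷ u) (g ∷ γ) = μ b g * tensor μs u γ

  applyToMonomial : ∀ {n} → Vec ℕ n → Vec (Bool → ℕ → ℝ) n → Monomial n → ℝ
  applyToMonomial []      []       []      = 1ᵣ
  applyToMonomial (m ∷ β) (μ ∷ μs) (a ∷ α) = applyToPower m μ a * applyToMonomial β μs α

  cubeFunctional : ∀ {n} → Vec ℕ n → Vec (Bool → ℕ → ℝ) n → Polynomial n → ℝ
  cubeFunctional β μs P = ∑box β (λ u γ → tensor μs u γ * eval (∂ᵛ γ P) (cubePoint u))

  ∑box-tensor-monoDeriv : ∀ {n} (β : Vec ℕ n) μs α →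
                          ∑box β (λ u γ → tensor μs u γ * monoDeriv α γ u) ≡ applyToMonomial β μs α
  ∑box-tensor-monoDeriv []      []       []      = *-identityˡ 1ᵣ
  ∑box-tensor-monoDeriv (m ∷ β) (μ ∷ μs) (a ∷ α) = begin
      ∑bit≤ m (λ b g → ∑box β (λ u γ → (μ b g * tensor μs u γ) * (powDeriv a g b * monoDeriv α γ u)))
        ≡⟨ ∑bit≤-cong m (λ b g _ → trans (∑box-cong β (λ u γ _ → regroup (μ b g) _ (powDeriv a g b) _))
                                         (∑box-*ˡ β (μ b g * powDeriv a g b) (λ u γ → tensor μs u γ * monoDeriv α γ u))) ⟩
      ∑bit≤ m (λ b g → (μ b g * powDeriv a g b) * ∑box β (λ u γ → tensor μs u γ * monoDeriv α γ u))
        ≡⟨ ∑bit≤-cong m (λ b g _ → cong (μ b g * powDeriv a g b *_) (∑box-tensor-monoDeriv β μs α)) ⟩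
      ∑bit≤ m (λ b g → (μ b g * powDeriv a g b) * A)
        ≡⟨ ∑bit≤-cong m (λ b g _ → *-comm (μ b g * powDeriv a g b) A) ⟩
      ∑bit≤ m (λ b g → A * (μ b g * powDeriv a g b))
        ≡⟨ ∑bit≤-*ˡ m A (λ b g → μ b g * powDeriv a g b) ⟩
      A * applyToPower m μ a
        ≡⟨ *-comm A _ ⟩
      applyToPower m μ a * A ∎
    where
      open ≡-Reasoning
      A : ℝ
      A = applyToMonomial β μs α
      regroup : ∀ x y z w → (x * y) * (z * w) ≡ (x * z) * (y * w)
      regroup = solve 4 (λ x y z w → (x :* y) :* (z :* w) := (x :* z) :* (y :* w)) refl

  cubeFunctional≡⟪⟫ : ∀ {n} (β : Vec ℕ n) μs P → cubeFunctional β μs P ≡ ⟪ P , applyToMonomial β μs ⟫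
  cubeFunctional≡⟪⟫ β μs []            = ∑box-zero β (λ u γ _ → zeroʳ _)
  cubeFunctional≡⟪⟫ β μs ((c , α) ∷ P) = begin
      ∑box β (λ u γ → T u γ * eval (∂ᵛ γ ((c , α) ∷ P)) (cubePoint u))
        ≡⟨ ∑box-cong β (λ u γ _ → cong (T u γ *_) (eval-∂ᵛ-cubePoint γ c α P u)) ⟩
      ∑box β (λ u γ → T u γ * (c * monoDeriv α γ u + eval (∂ᵛ γ P) (cubePoint u)))
        ≡⟨ ∑box-cong β (λ u γ _ → distrib (T u γ) c (monoDeriv α γ u) (eval (∂ᵛ γ P) (cubePoint u))) ⟩
      ∑box β (λ u γ → c * (T u γ * monoDeriv α γ u) + T u γ * eval (∂ᵛ γ P) (cubePoint u))
        ≡⟨ ∑box-+ β (λ u γ → c * (T u γ * monoDeriv α γ u)) (λ u γ → T u γ * eval (∂ᵛ γ P) (cubePoint u)) ⟩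
      ∑box β (λ u γ → c * (T u γ * monoDeriv α γ u)) + cubeFunctional β μs P
        ≡⟨ cong₂ _+_ (trans (∑box-*ˡ β c (λ u γ → T u γ * monoDeriv α γ u)) (cong (c *_) (∑box-tensor-monoDeriv β μs α))) (cubeFunctional≡⟪⟫ β μs P) ⟩
      c * applyToMonomial β μs α + ⟪ P , applyToMonomial β μs ⟫ ∎
    where
      open ≡-Reasoning
      T : Vec Bool _ → Vec ℕ _ → ℝ
      T = tensor μs
      distrib : ∀ t c d e → t * (c * d + e) ≡ c * (t * d) + t * e
      distrib = solve 4 (λ t c d e → t :* (c :* d :+ e) := c :* (t :* d) :+ t :* e) refl

  dual : Bool → Bool → ℕ → Bool → ℕ → ℝ
  dual L c m = UnivariateDual.μ (univariateDual L c m)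

  duals : ∀ {n} → Bool → Vec Bool n → Vec ℕ n → Vec (Bool → ℕ → ℝ) n
  duals L = zipWith (dual L)

  applyToMonomial-duals : ∀ {n} L (v : Vec Bool n) β α →
    totalDegree α < Vec.sum β ℕ.+ Vec.sum β ℕ.+ mismatches L v → applyToMonomial β (duals L v β) α ≡ 0ᵣ
  applyToMonomial-duals L []      []      []      ()
  applyToMonomial-duals L (c ∷ v) (m ∷ β) (a ∷ α) |a∷α|<bound with a ℕ.<? m ℕ.+ m ℕ.+ differs L c
  ... | yes a<order = trans (cong (_* applyToMonomial β (duals L v β) α) (UnivariateDual.annihilates (univariateDual L c m) a a<order)) (zeroˡ _)
  ... | no  a≮order = trans (cong (applyToPower m (dual L c m) a *_) (applyToMonomial-duals L v β α |α|<bound)) (zeroʳ _)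
    where
      regroup : ∀ m s d r → m ℕ.+ s ℕ.+ (m ℕ.+ s) ℕ.+ (d ℕ.+ r) ≡ m ℕ.+ m ℕ.+ d ℕ.+ (s ℕ.+ s ℕ.+ r)
      regroup = solve-∀
      |α|<bound : totalDegree α < Vec.sum β ℕ.+ Vec.sum β ℕ.+ mismatches L v
      |α|<bound = ℕ.+-cancelˡ-< (m ℕ.+ m ℕ.+ differs L c) _ _ (ℕ.≤-<-trans (ℕ.+-monoˡ-≤ _ (ℕ.≮⇒≥ a≮order))
                    (subst (a ℕ.+ totalDegree α <_) (regroup m (Vec.sum β) (differs L c) (mismatches L v)) |a∷α|<bound))

  private
    extend : ∀ {n L b c g} {μ : Bool → ℕ → ℝ} {μs u} {v : Vec Bool n} {γ} → (c ≡ L → b ≡ L) →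
             tensor μs u γ ≡ 0ᵣ ⊎ KeepsEntries L u v →
             tensor (μ ∷ μs) (b ∷ u) (g ∷ γ) ≡ 0ᵣ ⊎ KeepsEntries L (b ∷ u) (c ∷ v)
    extend {b = b} {g = g} {μ} keeps = Sum.map (λ t≡0 → trans (cong (μ b g *_) t≡0) (zeroʳ _)) (keeps ∷_)

  tensor-duals-top : ∀ {n} L (v : Vec Bool n) β u → tensor (duals L v β) u β ≡ 0ᵣ ⊎ KeepsEntries L u v
  tensor-duals-top L []      []      []      = inj₂ []
  tensor-duals-top L (c ∷ v) (m ∷ β) (b ∷ u) with L ≟ᵇ c | b ≟ᵇ c
  ... | yes L≡c | no b≢c  = inj₁ (trans (cong (_* _) μ-top-b≡0) (zeroˡ _))
    where
      μ-top-b≡0 : dual L c m b m ≡ 0ᵣ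
      μ-top-b≡0 = trans (cong (λ b → dual L c m b m) (¬-not b≢c))
                        (UnivariateDual.μ-top-not (univariateDual L c m) L≡c)
  ... | yes L≡c | yes b≡c = extend {μ = dual L c m} {μs = duals L v β} (λ c≡L → trans b≡c c≡L) (tensor-duals-top L v β u)
  ... | no  L≢c | _       = extend {μ = dual L c m} {μs = duals L v β} (λ c≡L → ⊥-elim (L≢c (sym c≡L))) (tensor-duals-top L v β u)

  tensor-duals-top-≢0 : ∀ {n} L (v : Vec Bool n) β → tensor (duals L v β) v β ≢ 0ᵣ
  tensor-duals-top-≢0 L []      []      = 1≢0
  tensor-duals-top-≢0 L (c ∷ v) (m ∷ β) = *-≢0 (UnivariateDual.μ-top-≢0 (univariateDual L c m)) (tensor-duals-top-≢0 L v β)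

  Pointwise-≤⇒sum-≤ : ∀ {n} {γ β : Vec ℕ n} → Pointwise _≤_ γ β → Vec.sum γ ≤ Vec.sum β
  Pointwise-≤⇒sum-≤ []          = z≤n
  Pointwise-≤⇒sum-≤ (g≤m ∷ γ≤β) = ℕ.+-mono-≤ g≤m (Pointwise-≤⇒sum-≤ γ≤β)

  Pointwise-≤∧≢⇒sum-< : ∀ {n} {γ β : Vec ℕ n} → Pointwise _≤_ γ β → γ ≢ β → Vec.sum γ < Vec.sum β
  Pointwise-≤∧≢⇒sum-< []                         γ≢β = ⊥-elim (γ≢β refl)
  Pointwise-≤∧≢⇒sum-< {γ = g ∷ γ} (g≤m ∷ γ≤β) g∷γ≢m∷β with ℕ.m≤n⇒m<n∨m≡n g≤m
  ... | inj₁ g<m  = ℕ.+-mono-<-≤ g<m (Pointwise-≤⇒sum-≤ γ≤β)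
  ... | inj₂ refl = ℕ.+-monoʳ-< g (Pointwise-≤∧≢⇒sum-< γ≤β (g∷γ≢m∷β ∘ cong (g ∷_)))

  ∂ᵛ-at-v≡0 : ∀ {n s} L (v : Vec Bool n) β (P : Polynomial n) → Vec.sum β ≡ s →
    (∀ α → s ℕ.+ s ℕ.+ mismatches L v ≤ totalDegree α → coeff P α ≡ 0ᵣ) →
    (∀ u → ZeroMultAtLeast P s (cubePoint u)) →
    (∀ u → KeepsEntries L u v → u ≢ v → ZeroMultAtLeast P (suc s) (cubePoint u)) →
    eval (∂ᵛ β P) (cubePoint v) ≡ 0ᵣ
  ∂ᵛ-at-v≡0 L v β P refl low-degree zero-everywhere zero-off-v = x*y≡0⇒y≡0 (tensor-duals-top-≢0 L v β) (begin
      F v β                          ≡⟨ sym (∑box-single β v β F (Pointwise.refl ℕ.≤-refl) F≡0) ⟩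
      cubeFunctional β μs P          ≡⟨ cubeFunctional≡⟪⟫ β μs P ⟩
      ⟪ P , applyToMonomial β μs ⟫   ≡⟨ ⟪⟫≡0 P (applyToMonomial β μs) coeff≡0∨apply≡0 ⟩
      0ᵣ                             ∎)
    where
      open ≡-Reasoning
      μs : Vec (Bool → ℕ → ℝ) _
      μs = duals L v β
      F : Vec Bool _ → Vec ℕ _ → ℝ
      F u γ = tensor μs u γ * eval (∂ᵛ γ P) (cubePoint u)
      coeff≡0∨apply≡0 : ∀ α → coeff P α ≡ 0ᵣ ⊎ applyToMonomial β μs α ≡ 0ᵣ
      coeff≡0∨apply≡0 α with Vec.sum β ℕ.+ Vec.sum β ℕ.+ mismatches L v ℕ.≤? totalDegree α
      ... | yes high = inj₁ (low-degree α high)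
      ... | no  low  = inj₂ (applyToMonomial-duals L v β α (ℕ.≰⇒> low))
      F≡0 : ∀ u γ → Pointwise _≤_ γ β → (u , γ) ≢ (v , β) → F u γ ≡ 0ᵣ
      F≡0 u γ γ≤β uγ≢vβ with Vec.≡-dec ℕ._≟_ γ β
      ... | no γ≢β = trans (cong (tensor μs u γ *_) (ZeroMultAtLeast⇒∂ᵛ≡0 (zero-everywhere u) γ
                             (Pointwise-≤∧≢⇒sum-< γ≤β γ≢β))) (zeroʳ _)
      ... | yes refl with tensor-duals-top L v β u
      ...   | inj₁ t≡0   = trans (cong (_* eval (∂ᵛ β P) (cubePoint u)) t≡0) (zeroˡ _)
      ...   | inj₂ keeps = trans (cong (tensor μs u β *_) (ZeroMultAtLeast⇒∂ᵛ≡0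
                             (zero-off-v u keeps (λ u≡v → uγ≢vβ (cong (_, β) u≡v))) β ℕ.≤-refl)) (zeroʳ _)

  multiplicity-at-v : ∀ {n} s L (v : Vec Bool n) (P : Polynomial n) →
    (∀ α → s ℕ.+ s ℕ.+ mismatches L v ≤ totalDegree α → coeff P α ≡ 0ᵣ) →
    (∀ u → ZeroMultAtLeast P s (cubePoint u)) →
    (∀ u → KeepsEntries L u v → u ≢ v → ZeroMultAtLeast P (suc s) (cubePoint u)) →
    ZeroMultAtLeast P (suc s) (cubePoint v)
  multiplicity-at-v s L v P low-degree zero-everywhere zero-off-v = ZeroMultAtLeast-suc (zero-everywhere v)
    (λ β |β|≡s → ∂ᵛ-at-v≡0 L v β P |β|≡s low-degree zero-everywhere zero-off-v)

open import Data.Nat using (ℕ; _≤_; _+_; _*_; _∸_; _⊔_)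
open import Data.Bool using (Bool)
open import Data.Vec using (Vec)
open import Relation.Binary.PropositionalEquality using (_≡_; _≢_)

theorem1p3 : (Rf : RealField) →
    (n t k : ℕ) → 1 ≤ t → 1 ≤ k → k ≤ n → (P : Poly.Polynomial Rf n) →
    (∀ (u : Vec Bool n) → Poly.weight Rf u ≢ k →
    Poly.ZeroMultAtLeast Rf P t (Poly.cubePoint Rf u)) →
    (∀ (v : Vec Bool n) → Poly.weight Rf v ≡ k →
    Poly.ZeroMultExactly Rf P (t ∸ 1) (Poly.cubePoint Rf v)) →
    Poly.DegreeAtLeast Rf P ((k ⊔ (n ∸ k)) + 2 * (t ∸ 1))
theorem1p3 Rf n zero    k () _ _ _ _ _
theorem1p3 Rf n (suc t) k _ _ k≤n P zero-off-layer exact-on-layer low-degree =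
  proj₂ (exact-on-layer v |v|≡k) (multiplicity-at-v t L v P degree-bound zero-to-order-t zero-off-v)
  where
    open RealField Rf using (0ᵣ)
    open Poly Rf
    open CubeFunctional Rf using (multiplicity-at-v)
    open BooleanVectors using (KeepsEntries; mismatches; mismatches-⊔; count-true-any; KeepsEntries∧count-true-≡⇒≡)
    v : Vec Bool n
    v = proj₁ (count-true-any k≤n)
    |v|≡k : weight v ≡ k
    |v|≡k = proj₂ (count-true-any k≤n)
    L : Bool
    L = proj₁ (mismatches-⊔ v)
    degree-bound : ∀ α → t + t + mismatches L v ≤ totalDegree α → coeff P α ≡ 0ᵣ
    degree-bound α = low-degree α ∘ subst (_≤ totalDegree α)
      (trans (cong (t + t +_) (trans (proj₂ (mismatches-⊔ v)) (cong (λ k → k ⊔ (n ∸ k)) |v|≡k)))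
             (+-comm-2* t (k ⊔ (n ∸ k))))
      where
        +-comm-2* : ∀ t m → t + t + m ≡ m + 2 * t
        +-comm-2* = solve-∀
    zero-to-order-t : ∀ u → ZeroMultAtLeast P t (cubePoint u)
    zero-to-order-t u with weight u ℕ.≟ k
    ... | yes |u|≡k = proj₁ (exact-on-layer u |u|≡k)
    ... | no  |u|≢k = λ is |is|<t → zero-off-layer u |u|≢k is (ℕ.m≤n⇒m≤1+n |is|<t)
    zero-off-v : ∀ u → KeepsEntries L u v → u ≢ v → ZeroMultAtLeast P (suc t) (cubePoint u)
    zero-off-v u keeps u≢v = zero-off-layer u (λ |u|≡k → u≢v (KeepsEntries∧count-true-≡⇒≡ L keeps (trans |u|≡k (sym |v|≡k))))
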